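{- Let $n\ge 3$. The wheel $W_n$ (of order $n+1$) admits an $(a,d)$-distance antimagic labeling for some integers $a$ and $d\ge 0$ if and only if $3\le n\le 5$.
   Context: The wheel $W_n$ is obtained from a cycle $C_n$ by adding a new vertex (the center) adjacent to all vertices of the cycle. For a graph $G$ with $v$ vertices and a bijection $f:V(G)\to\{1,\ldots,v\}$, the vertex-weight of $x$ is $w(x)=\sum_{y\in N(x)} f(y)$, $N(x)$ the set of neighbors of $x$. $f$ is an $(a,d)$-distance antimagic labeling, for fixed integers $a$ and $d\ge 0$, if the multiset of vertex-weights is $\{a,a+d,\ldots,a+(v-1)d\}$ (for $d=0$ this means all weights are equal). -}

module Defs where

open import Data.Nat using (ℕ; zero; suc; _+_; _*_; _%_; NonZero)
open import Data.Nat.Properties using (_≟_)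
open import Data.Fin using (Fin; toℕ) renaming (zero to fzero; suc to fsuc)
open import Data.Bool using (Bool; true; false; _∨_; if_then_else_)
open import Data.Integer using (ℤ; +_; _≤_) renaming (_+_ to _+ℤ_; _*_ to _*ℤ_)
open import Data.Product using (Σ; _×_; ∃)
open import Function.Bundles using (_⤖_; Bijection)
open import Relation.Binary.PropositionalEquality using (_≡_)
open import Relation.Nullary.Decidable using (⌊_⌋)

sumFin : (m : ℕ) → (Fin m → ℕ) → ℕ
sumFin zero    g = 0
sumFin (suc m) g = g fzero + sumFin m (λ i → g (fsuc i))

cycleAdj : (n : ℕ) → .{{NonZero n}} → Fin n → Fin n → Bool
cycleAdj n i j = ⌊ toℕ j ≟ (suc (toℕ i)) % n ⌋ ∨ ⌊ toℕ i ≟ (suc (toℕ j)) % n ⌋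

-- Wheel W_n on vertex set Fin (suc n): fzero is the center, fsuc i is
-- the i-th vertex of the cycle C_n.
wheelAdj : (n : ℕ) → .{{NonZero n}} → Fin (suc n) → Fin (suc n) → Bool
wheelAdj n fzero    fzero    = false
wheelAdj n fzero    (fsuc j) = true
wheelAdj n (fsuc i) fzero    = true
wheelAdj n (fsuc i) (fsuc j) = cycleAdj n i j

-- Vertex weight w(x) = sum of labels of neighbours of x, where the
-- labeling f : V → {1,…,v} is represented by f : Fin v → Fin v, label = 1 + toℕ (f y).
wheelWeight : (n : ℕ) → .{{NonZero n}} → (Fin (suc n) → Fin (suc n)) → Fin (suc n) → ℕ
wheelWeight n f x =
  sumFin (suc n) (λ y → if wheelAdj n x y then suc (toℕ (f y)) else 0)

-- f is an (a,d)-distance antimagic labeling of W_n: f is a bijection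
-- V → {1,…,v} and the multiset of weights is {a, a+d, …, a+(v-1)d},
-- i.e. there is a bijection σ : V → {0,…,v-1} with w(x) = a + σ(x)·d.
IsDistanceAntimagicWheel : (n : ℕ) → .{{NonZero n}} → ℤ → ℤ → (Fin (suc n) ⤖ Fin (suc n)) → Set
IsDistanceAntimagicWheel n a d f =
  Σ (Fin (suc n) ⤖ Fin (suc n)) λ σ →
    ∀ x → + (wheelWeight n (Bijection.to f) x) ≡ a +ℤ (+ toℕ (Bijection.to σ x)) *ℤ d

WheelAdmitsDAL : (n : ℕ) → .{{NonZero n}} → Set
WheelAdmitsDAL n =
  Σ ℤ λ a → Σ ℤ λ d → (+ 0 ≤ d) × Σ (Fin (suc n) ⤖ Fin (suc n)) λ f →
    IsDistanceAntimagicWheel n a d f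

-- A rim vertex is adjacent to the centre and to two rim vertices, so its weight is a sum of
-- three distinct labels from {1, …, n+1} and lies in [6, 3n], while the centre weight is
-- (n+1)(n+2)/2 minus the centre label. The weights form an arithmetic progression
-- a, a+d, …, a+nd. If its top term is a rim weight, the centre weight is at most 3n.
-- Otherwise the centre carries the top term, and the bottom term a ≥ 6 and the term
-- a+(n-1)d ≤ 3n are rim weights, so d ≤ 2 and the centre weight is at most 3n+2. Either way
-- (n+1)(n+2)/2 ≤ (n+1) + 3n + 2, which fails for n ≥ 6. For n = 3, 4, 5 explicit labelings
-- are checked by computation.
module Submission where

open import Defs
import Algebra.Properties.CommutativeMonoid.Sum as CommutativeMonoidSum
open import Data.Bool using (Bool; true; false; T; if_then_else_)
open import Data.Bool.Properties using (T-∨)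
open import Data.Empty using (⊥-elim)
open import Data.Fin using (Fin; toℕ; fromℕ; fromℕ<; inject₁; #_) renaming (zero to fzero; suc to fsuc)
open import Data.Fin.Properties
  using ( _≟_; all?; any?; toℕ-injective; toℕ<n; toℕ≤pred[n]; toℕ-fromℕ; toℕ-fromℕ<; toℕ-inject₁
        ; fromℕ≢inject₁)
  renaming (suc-injective to fsuc-injective; 0≢1+n to fzero≢fsuc)
open import Data.Integer as ℤ using (ℤ; +_; -[1+_]; +≤+)
import Data.Integer.Properties as ℤP
import Data.Nat as ℕ
open import Data.Nat using (ℕ; zero; suc; _+_; _*_; _%_; _≤_; _<_; _≤?_; z≤n; s≤s; NonZero)
open import Data.Nat.DivMod using (n%n≡0; m%n<n; m<n⇒m%n≡m)
open import Data.Nat.Properties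
  using ( +-0-commutativeMonoid; +-identityʳ; +-suc; +-cancelʳ-≡
        ; +-mono-≤; +-monoˡ-≤; +-monoˡ-<; +-monoʳ-≤; *-monoˡ-≤; *-monoʳ-≤
        ; suc-injective; 0≢1+n; m≤m+n; m<m+n; m≢1+n+m
        ; <⇒≢; <⇒≱; ≰⇒>; ≤-refl; ≤-trans; <-cmp; m≤n⇒m<n∨m≡n; module ≤-Reasoning)
open import Data.Nat.Tactic.RingSolver using (solve-∀)
open import Data.Product using (_×_; _,_; ∃; proj₁; proj₂)
open import Data.Sum using (_⊎_; inj₁; inj₂; [_,_])
open import Data.Sum.Function.Propositional using (_⊎-⇔_)
open import Data.Vec using (Vec; _∷_; []; lookup)
open import Function using (_∘_)
open import Function.Bundles using (_⇔_; _⤖_; mk⇔; mk⤖; Equivalence; Bijection)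
open import Function.Construct.Identity using (⤖-id)
open import Function.Consequences.Propositional using (strictlySurjective⇒surjective)
open import Function.Definitions using (Injective)
open import Function.Properties.Bijection using (⤖⇒↔)
import Function.Properties.Equivalence as ⇔
open import Relation.Binary.Definitions using (Tri; tri<; tri≈; tri>)
open import Relation.Binary.PropositionalEquality hiding ([_])
open import Relation.Nullary using (¬_; Dec; yes; no; does)
open import Relation.Nullary.Decidable using (True; toWitness; fromWitness; _→-dec_)
open import Relation.Unary using (Decidable)

sumFin-cong : ∀ m {g h : Fin m → ℕ} → (∀ i → g i ≡ h i) → sumFin m g ≡ sumFin m h
sumFin-cong zero    g≗h = refl
sumFin-cong (suc m) g≗h = cong₂ _+_ (g≗h fzero) (sumFin-cong m (g≗h ∘ fsuc))

sumFin-zero : ∀ m → sumFin m (λ _ → 0) ≡ 0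
sumFin-zero zero    = refl
sumFin-zero (suc m) = sumFin-zero m

module ℕ-Sum = CommutativeMonoidSum +-0-commutativeMonoid

sumFin≡sum : ∀ m (g : Fin m → ℕ) → sumFin m g ≡ ℕ-Sum.sum g
sumFin≡sum zero    g = refl
sumFin≡sum (suc m) g = cong (_+_ (g fzero)) (sumFin≡sum m (g ∘ fsuc))

sumFin-+ : ∀ m (g h : Fin m → ℕ) → sumFin m (λ i → g i + h i) ≡ sumFin m g + sumFin m h
sumFin-+ m g h = begin
  sumFin m (λ i → g i + h i)   ≡⟨ sumFin≡sum m _ ⟩
  ℕ-Sum.sum (λ i → g i + h i)  ≡⟨ ℕ-Sum.∑-distrib-+ g h ⟩
  ℕ-Sum.sum g + ℕ-Sum.sum h    ≡⟨ sym (cong₂ _+_ (sumFin≡sum m g) (sumFin≡sum m h)) ⟩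
  sumFin m g + sumFin m h      ∎
  where open ≡-Reasoning

sumFin-permute : ∀ {m} (g : Fin m → ℕ) (π : Fin m ⤖ Fin m) →
  sumFin m (g ∘ Bijection.to π) ≡ sumFin m g
sumFin-permute {m} g π = begin
  sumFin m (g ∘ Bijection.to π)  ≡⟨ sumFin≡sum m _ ⟩
  ℕ-Sum.sum (g ∘ Bijection.to π) ≡⟨ sym (ℕ-Sum.sum-permute g (⤖⇒↔ π)) ⟩
  ℕ-Sum.sum g                    ≡⟨ sym (sumFin≡sum m g) ⟩
  sumFin m g                     ∎
  where open ≡-Reasoning

-- does rather than ⌊_⌋: ⌊ fsuc i ≟ fsuc p ⌋ does not reduce to ⌊ i ≟ p ⌋.
sumFin-δ : ∀ m (g : Fin m → ℕ) p → sumFin m (λ i → if does (i ≟ p) then g i else 0) ≡ g p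
sumFin-δ (suc m) g fzero    = trans (cong (_+_ (g fzero)) (sumFin-zero m)) (+-identityʳ (g fzero))
sumFin-δ (suc m) g (fsuc p) = sumFin-δ m (g ∘ fsuc) p

sumFin-pair : ∀ m (P : Fin m → Bool) (g : Fin m → ℕ) {p q} → p ≢ q →
  (∀ i → T (P i) ⇔ (i ≡ p ⊎ i ≡ q)) →
  sumFin m (λ i → if P i then g i else 0) ≡ g p + g q
sumFin-pair m P g {p} {q} p≢q P⇔ = begin
  sumFin m (λ i → if P i then g i else 0) ≡⟨ sumFin-cong m split ⟩
  sumFin m (λ i → δ p i + δ q i)          ≡⟨ sumFin-+ m (δ p) (δ q) ⟩
  sumFin m (δ p) + sumFin m (δ q)         ≡⟨ cong₂ _+_ (sumFin-δ m g p) (sumFin-δ m g q) ⟩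
  g p + g q                               ∎
  where
  open ≡-Reasoning
  δ : Fin m → Fin m → ℕ
  δ r i = if does (i ≟ r) then g i else 0
  split : ∀ i → (if P i then g i else 0) ≡ δ p i + δ q i
  split i with P i | P⇔ i | i ≟ p | i ≟ q
  ... | true  | _   | yes i≡p | yes i≡q = ⊥-elim (p≢q (trans (sym i≡p) i≡q))
  ... | true  | _   | yes _   | no _    = sym (+-identityʳ (g i))
  ... | true  | _   | no _    | yes _   = refl
  ... | true  | P⇔i | no i≢p  | no i≢q  = ⊥-elim ([ i≢p , i≢q ] (Equivalence.to P⇔i _))
  ... | false | P⇔i | yes i≡p | _       = ⊥-elim (Equivalence.from P⇔i (inj₁ i≡p))
  ... | false | P⇔i | no _    | yes i≡q = ⊥-elim (Equivalence.from P⇔i (inj₂ i≡q))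
  ... | false | _   | no _    | no _    = refl

sumFin-shift : ∀ m k → 2 * sumFin m (λ i → k + toℕ i) + m ≡ m * (2 * k + m)
sumFin-shift zero    k = refl
sumFin-shift (suc m) k = begin
  2 * (k + 0 + S) + suc m             ≡⟨ regroup k m S ⟩
  suc (2 * k) + (2 * S + m)           ≡⟨ cong (_+_ (suc (2 * k))) shifted ⟩
  suc (2 * k) + m * (2 * suc k + m)   ≡⟨ expand k m ⟩
  suc m * (2 * k + suc m)             ∎
  where
  open ≡-Reasoning
  S : ℕ
  S = sumFin m (λ i → k + suc (toℕ i))
  shifted : 2 * S + m ≡ m * (2 * suc k + m)
  shifted = trans (cong (λ s → 2 * s + m) (sumFin-cong m (λ i → +-suc k (toℕ i)))) (sumFin-shift m (suc k))
  regroup : ∀ k m S → 2 * (k + 0 + S) + suc m ≡ suc (2 * k) + (2 * S + m)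
  regroup = solve-∀
  expand : ∀ k m → suc (2 * k) + m * (2 * suc k + m) ≡ suc m * (2 * k + suc m)
  expand = solve-∀

sumFin-labels : ∀ m → 2 * sumFin m (suc ∘ toℕ) ≡ m * suc m
sumFin-labels m = +-cancelʳ-≡ m _ _ (trans (sumFin-shift m 1) (expand m))
  where
  expand : ∀ m → m * (2 + m) ≡ m * suc m + m
  expand = solve-∀

next : ∀ {n} → Fin (suc n) → Fin (suc n)
next {n} i = fromℕ< (m%n<n (suc (toℕ i)) (suc n))

prev : ∀ {n} → Fin (suc n) → Fin (suc n)
prev {n} fzero    = fromℕ n
prev     (fsuc i) = inject₁ i

Follows : ∀ {n} → Fin (suc n) → Fin (suc n) → Set
Follows {n} i j = toℕ j ≡ suc (toℕ i) % suc n

follows-next : ∀ {n} (i : Fin (suc n)) → Follows i (next i)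
follows-next i = toℕ-fromℕ< _

follows⇒≡next : ∀ {n} {i j : Fin (suc n)} → Follows i j → j ≡ next i
follows⇒≡next i↝j = toℕ-injective (trans i↝j (sym (toℕ-fromℕ< _)))

follows-prev : ∀ {n} (i : Fin (suc n)) → Follows (prev i) i
follows-prev {n} fzero = begin
  0                         ≡⟨ sym (n%n≡0 (suc n)) ⟩
  suc n % suc n             ≡⟨ cong (λ k → suc k % suc n) (sym (toℕ-fromℕ n)) ⟩
  suc (toℕ (fromℕ n)) % suc n ∎
  where open ≡-Reasoning
follows-prev {n} (fsuc i) = begin
  suc (toℕ i)                 ≡⟨ sym (m<n⇒m%n≡m (s≤s (toℕ<n i))) ⟩
  suc (toℕ i) % suc n         ≡⟨ cong (λ k → suc k % suc n) (sym (toℕ-inject₁ i)) ⟩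
  suc (toℕ (inject₁ i)) % suc n ∎
  where open ≡-Reasoning

follows⇒≡prev : ∀ {n} {i j : Fin (suc n)} → Follows i j → i ≡ prev j
follows⇒≡prev {n} {i} {j} i↝j with m≤n⇒m<n∨m≡n (toℕ≤pred[n] i) | j
... | inj₁ i<n | fzero  = ⊥-elim (0≢1+n (trans i↝j (m<n⇒m%n≡m (s≤s i<n))))
... | inj₁ i<n | fsuc k = toℕ-injective (begin
  toℕ i           ≡⟨ suc-injective (sym (trans i↝j (m<n⇒m%n≡m (s≤s i<n)))) ⟩
  toℕ k           ≡⟨ sym (toℕ-inject₁ k) ⟩
  toℕ (inject₁ k) ∎)
  where open ≡-Reasoning
... | inj₂ i≡n | fzero  = toℕ-injective (trans i≡n (sym (toℕ-fromℕ n)))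
... | inj₂ i≡n | fsuc k =
  ⊥-elim (0≢1+n (sym (trans i↝j (trans (cong (λ k → suc k % suc n) i≡n) (n%n≡0 (suc n))))))

prev-prev≢id : ∀ {n} → 2 ≤ n → (i : Fin (suc n)) → prev (prev i) ≢ i
prev-prev≢id (s≤s (s≤s _)) fzero               ()
prev-prev≢id (s≤s (s≤s _)) (fsuc fzero)        ()
prev-prev≢id (s≤s (s≤s _)) (fsuc (fsuc i)) eq = m≢1+n+m (toℕ i) {1} (begin
  toℕ i                     ≡⟨ trans (toℕ-inject₁ (inject₁ i)) (toℕ-inject₁ i) ⟨
  toℕ (inject₁ (inject₁ i)) ≡⟨ cong toℕ eq ⟩
  suc (suc (toℕ i))         ∎)
  where open ≡-Reasoning

next≢prev : ∀ {n} → 2 ≤ n → (i : Fin (suc n)) → next i ≢ prev i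
next≢prev 2≤n i next≡prev = prev-prev≢id 2≤n i (begin
  prev (prev i) ≡⟨ cong prev next≡prev ⟨
  prev (next i) ≡⟨ follows⇒≡prev (follows-next i) ⟨
  i             ∎)
  where open ≡-Reasoning

cycleAdj-neighbours : ∀ {n} (i j : Fin (suc n)) → T (cycleAdj (suc n) i j) ⇔ (j ≡ next i ⊎ j ≡ prev i)
cycleAdj-neighbours {n} i j =
  ⇔.trans T-∨ (⇔.trans (True⇔ (toℕ j ℕ.≟ suc (toℕ i) % suc n) ⊎-⇔
                        True⇔ (toℕ i ℕ.≟ suc (toℕ j) % suc n))
                       (≡next ⊎-⇔ ≡prev))
  where
  True⇔ : ∀ {A : Set} (a? : Dec A) → True a? ⇔ A
  True⇔ _ = mk⇔ toWitness fromWitness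
  ≡next : Follows i j ⇔ (j ≡ next i)
  ≡next = mk⇔ follows⇒≡next (λ { refl → follows-next i })
  ≡prev : Follows j i ⇔ (j ≡ prev i)
  ≡prev = mk⇔ follows⇒≡prev (λ { refl → follows-prev i })

label : ∀ {v} → (Fin v → Fin v) → Fin v → ℕ
label f x = suc (toℕ (f x))

wheelWeight-rim : ∀ {n} → 2 ≤ n → (f : Fin (2 + n) → Fin (2 + n)) (i : Fin (suc n)) →
  wheelWeight (suc n) f (fsuc i) ≡ label f fzero + (label f (fsuc (next i)) + label f (fsuc (prev i)))
wheelWeight-rim {n} 2≤n f i =
  cong (_+_ (label f fzero))
       (sumFin-pair (suc n) (cycleAdj (suc n) i) (label f ∘ fsuc) (next≢prev 2≤n i) (cycleAdj-neighbours i))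

sorted-sum-bounds : ∀ {n a b c} → a < b → b < c → c ≤ n →
  6 ≤ suc a + (suc b + suc c) × suc a + (suc b + suc c) ≤ 3 * n
sorted-sum-bounds {n} {a} {b} {c} a<b b<c c≤n = lower , upper
  where
  open ≤-Reasoning
  1≤b : 1 ≤ b
  1≤b = ≤-trans (s≤s z≤n) a<b
  lower : 6 ≤ suc a + (suc b + suc c)
  lower = +-mono-≤ (s≤s (z≤n {a})) (+-mono-≤ (s≤s 1≤b) (s≤s (≤-trans (s≤s 1≤b) b<c)))
  upper : suc a + (suc b + suc c) ≤ 3 * n
  upper = begin
    suc a + (suc b + suc c) ≤⟨ +-mono-≤ a<b (+-monoˡ-≤ (suc c) b<c) ⟩
    b + (c + suc c)         ≡⟨ regroup b c ⟩
    suc b + (c + c)         ≤⟨ +-mono-≤ (≤-trans b<c c≤n) (+-mono-≤ c≤n c≤n) ⟩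
    n + (n + n)             ≡⟨ triple n ⟩
    3 * n                   ∎
    where
    regroup : ∀ b c → b + (c + suc c) ≡ suc b + (c + c)
    regroup = solve-∀
    triple : ∀ n → n + (n + n) ≡ 3 * n
    triple = solve-∀

distinct-sum-bounds : ∀ {n a b c} → a ≤ n → b ≤ n → c ≤ n → a ≢ b → a ≢ c → b ≢ c →
  6 ≤ suc a + (suc b + suc c) × suc a + (suc b + suc c) ≤ 3 * n
distinct-sum-bounds {n} {a} {b} {c} a≤n b≤n c≤n a≢b a≢c b≢c = by-order (<-cmp a b) (<-cmp b c) (<-cmp a c)
  where
  Bounds : ℕ → Set
  Bounds s = 6 ≤ s × s ≤ 3 * n
  reorder : ∀ {s t} → s ≡ t → Bounds t → Bounds s
  reorder refl bounds = bounds
  acb : ∀ a b c → suc a + (suc b + suc c) ≡ suc a + (suc c + suc b)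
  acb = solve-∀
  bac : ∀ a b c → suc a + (suc b + suc c) ≡ suc b + (suc a + suc c)
  bac = solve-∀
  bca : ∀ a b c → suc a + (suc b + suc c) ≡ suc b + (suc c + suc a)
  bca = solve-∀
  cab : ∀ a b c → suc a + (suc b + suc c) ≡ suc c + (suc a + suc b)
  cab = solve-∀
  cba : ∀ a b c → suc a + (suc b + suc c) ≡ suc c + (suc b + suc a)
  cba = solve-∀
  by-order : Tri (a < b) (a ≡ b) (b < a) → Tri (b < c) (b ≡ c) (c < b) → Tri (a < c) (a ≡ c) (c < a) →
    Bounds (suc a + (suc b + suc c))
  by-order (tri≈ _ a≡b _) _              _              = ⊥-elim (a≢b a≡b)
  by-order _              (tri≈ _ b≡c _) _              = ⊥-elim (b≢c b≡c)
  by-order _              _              (tri≈ _ a≡c _) = ⊥-elim (a≢c a≡c)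
  by-order (tri< a<b _ _) (tri< b<c _ _) _              = sorted-sum-bounds a<b b<c c≤n
  by-order (tri< a<b _ _) (tri> _ _ c<b) (tri< a<c _ _) = reorder (acb a b c) (sorted-sum-bounds a<c c<b b≤n)
  by-order (tri< a<b _ _) (tri> _ _ c<b) (tri> _ _ c<a) = reorder (cab a b c) (sorted-sum-bounds c<a a<b b≤n)
  by-order (tri> _ _ b<a) (tri< b<c _ _) (tri< a<c _ _) = reorder (bac a b c) (sorted-sum-bounds b<a a<c c≤n)
  by-order (tri> _ _ b<a) (tri< b<c _ _) (tri> _ _ c<a) = reorder (bca a b c) (sorted-sum-bounds b<c c<a a≤n)
  by-order (tri> _ _ b<a) (tri> _ _ c<b) _              = reorder (cba a b c) (sorted-sum-bounds c<b b<a a≤n)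

rimWeight-bounds : ∀ {n} → 2 ≤ n → (f : Fin (2 + n) → Fin (2 + n)) → Injective _≡_ _≡_ f →
  (i : Fin (suc n)) →
  6 ≤ wheelWeight (suc n) f (fsuc i) × wheelWeight (suc n) f (fsuc i) ≤ 3 * suc n
rimWeight-bounds 2≤n f f-inj i rewrite wheelWeight-rim 2≤n f i =
  distinct-sum-bounds
    (toℕ≤pred[n] (f fzero)) (toℕ≤pred[n] (f (fsuc (next i)))) (toℕ≤pred[n] (f (fsuc (prev i))))
    centre≢rim centre≢rim (next≢prev 2≤n i ∘ fsuc-injective ∘ f-inj ∘ toℕ-injective)
  where
  centre≢rim : ∀ {j} → toℕ (f fzero) ≢ toℕ (f (fsuc j))
  centre≢rim = fzero≢fsuc ∘ f-inj ∘ toℕ-injective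

progression-ℕ : ∀ {A : Set} (w r : A → ℕ) (a : ℤ) (e : ℕ) {x₀} → r x₀ ≡ 0 →
  (∀ x → + w x ≡ a ℤ.+ + r x ℤ.* + e) → ∀ x → w x ≡ w x₀ + r x * e
progression-ℕ w r a e {x₀} r₀≡0 w≡ x = ℤP.+-injective (begin
  + w x                      ≡⟨ w≡ x ⟩
  a ℤ.+ + r x ℤ.* + e        ≡⟨ cong₂ ℤ._+_ a≡w₀ (sym (ℤP.pos-* (r x) e)) ⟩
  + w x₀ ℤ.+ + (r x * e)     ≡⟨ sym (ℤP.pos-+ (w x₀) (r x * e)) ⟩
  + (w x₀ + r x * e)         ∎)
  where
  open ≡-Reasoning
  a≡w₀ : a ≡ + w x₀
  a≡w₀ = sym (trans (w≡ x₀) (trans (cong (λ k → a ℤ.+ + k ℤ.* + e) r₀≡0) (ℤP.+-identityʳ a)))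

6+k*e≤3[1+k]⇒e≤2 : ∀ k e → 6 + k * e ≤ 3 * suc k → e ≤ 2
6+k*e≤3[1+k]⇒e≤2 k e bound with e ≤? 2
... | yes e≤2 = e≤2
... | no  e≰2 = ⊥-elim (<⇒≱ (begin-strict
  3 * suc k  ≡⟨ expand k ⟩
  3 + k * 3  <⟨ +-monoˡ-< (k * 3) (s≤s (s≤s (s≤s (s≤s z≤n)))) ⟩
  6 + k * 3  ≤⟨ +-monoʳ-≤ 6 (*-monoʳ-≤ k (≰⇒> e≰2)) ⟩
  6 + k * e  ∎) bound)
  where
  open ≤-Reasoning
  expand : ∀ k → 3 * suc k ≡ 3 + k * 3
  expand = solve-∀

centreWeight-bound : ∀ k (σ : Fin (2 + k) ⤖ Fin (2 + k)) (w : Fin (2 + k) → ℕ) (w₀ e : ℕ) →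
  (∀ x → w x ≡ w₀ + toℕ (Bijection.to σ x) * e) →
  (∀ i → 6 ≤ w (fsuc i) × w (fsuc i) ≤ 3 * suc k) →
  w fzero ≤ 3 * suc k + 2
centreWeight-bound k σ w w₀ e w≡ rim = by-top (preimage (fromℕ (suc k)))
  where
  open ≤-Reasoning
  Preimage : Fin (2 + k) → Set
  Preimage r = ∃ λ x → Bijection.to σ x ≡ r
  preimage : ∀ r → Preimage r
  preimage = Bijection.strictlySurjective σ
  at : ∀ {x r} → Bijection.to σ x ≡ r → w x ≡ w₀ + toℕ r * e
  at {x} σx≡r = trans (w≡ x) (cong (λ r → w₀ + toℕ r * e) σx≡r)
  at-top : ∀ {x} → Bijection.to σ x ≡ fromℕ (suc k) → w x ≡ w₀ + suc k * e
  at-top σx≡top = trans (at σx≡top) (cong (λ t → w₀ + t * e) (toℕ-fromℕ (suc k)))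

  centre-on-top : Bijection.to σ fzero ≡ fromℕ (suc k) →
    Preimage fzero → Preimage (inject₁ (fromℕ k)) → w fzero ≤ 3 * suc k + 2
  centre-on-top σ0≡top (fzero , σ0≡0) _ = ⊥-elim (fzero≢fsuc (trans (sym σ0≡0) σ0≡top))
  centre-on-top σ0≡top (fsuc _ , _) (fzero , σ0≡k) =
    ⊥-elim (fromℕ≢inject₁ (trans (sym σ0≡top) σ0≡k))
  centre-on-top σ0≡top (fsuc i₀ , σi₀≡0) (fsuc i₁ , σi₁≡k) = begin
    w fzero            ≡⟨ at-top σ0≡top ⟩
    w₀ + suc k * e     ≡⟨ split w₀ k e ⟩
    (w₀ + k * e) + e   ≤⟨ +-mono-≤ penultimate≤ e≤2 ⟩
    3 * suc k + 2      ∎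
    where
    split : ∀ w₀ k e → w₀ + suc k * e ≡ (w₀ + k * e) + e
    split = solve-∀
    bottom≡ : w (fsuc i₀) ≡ w₀
    bottom≡ = trans (at σi₀≡0) (+-identityʳ w₀)
    penultimate≡ : w (fsuc i₁) ≡ w₀ + k * e
    penultimate≡ =
      trans (at σi₁≡k) (cong (λ t → w₀ + t * e) (trans (toℕ-inject₁ (fromℕ k)) (toℕ-fromℕ k)))
    penultimate≤ : w₀ + k * e ≤ 3 * suc k
    penultimate≤ = subst (_≤ 3 * suc k) penultimate≡ (proj₂ (rim i₁))
    e≤2 : e ≤ 2
    e≤2 = 6+k*e≤3[1+k]⇒e≤2 k e
            (≤-trans (+-monoˡ-≤ (k * e) (subst (6 ≤_) bottom≡ (proj₁ (rim i₀)))) penultimate≤)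

  by-top : Preimage (fromℕ (suc k)) → w fzero ≤ 3 * suc k + 2
  by-top (fzero , σ0≡top) = centre-on-top σ0≡top (preimage fzero) (preimage (inject₁ (fromℕ k)))
  by-top (fsuc i , σi≡top) = begin
    w fzero                  ≡⟨ at refl ⟩
    w₀ + toℕ σ₀ * e          ≤⟨ +-monoʳ-≤ w₀ (*-monoˡ-≤ e (toℕ≤pred[n] σ₀)) ⟩
    w₀ + suc k * e           ≡⟨ at-top σi≡top ⟨
    w (fsuc i)               ≤⟨ proj₂ (rim i) ⟩
    3 * suc k                ≤⟨ m≤m+n (3 * suc k) 2 ⟩
    3 * suc k + 2            ∎
    where
    σ₀ : Fin (2 + k)
    σ₀ = Bijection.to σ fzero

2[c+w]<[7+m][8+m] : ∀ m {c w} → c ≤ 7 + m → w ≤ 3 * (6 + m) + 2 → 2 * (c + w) < (7 + m) * (8 + m)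
2[c+w]<[7+m][8+m] m {c} {w} c≤ w≤ = begin-strict
  2 * (c + w)                                  ≤⟨ *-monoʳ-≤ 2 (+-mono-≤ c≤ w≤) ⟩
  2 * ((7 + m) + (3 * (6 + m) + 2))            ≡⟨ collect m ⟩
  54 + 8 * m                                   <⟨ m<m+n (54 + 8 * m) (s≤s z≤n) ⟩
  (54 + 8 * m) + (2 + 7 * m + m * m)           ≡⟨ expand m ⟩
  (7 + m) * (8 + m)                            ∎
  where
  open ≤-Reasoning
  collect : ∀ m → 2 * ((7 + m) + (3 * (6 + m) + 2)) ≡ 54 + 8 * m
  collect = solve-∀
  expand : ∀ m → (54 + 8 * m) + (2 + 7 * m + m * m) ≡ (7 + m) * (8 + m)
  expand = solve-∀

¬wheelAdmitsDAL-6+ : ∀ m → ¬ WheelAdmitsDAL (6 + m)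
¬wheelAdmitsDAL-6+ m (_ , -[1+ _ ] , () , _)
¬wheelAdmitsDAL-6+ m (a , + e , _ , f , σ , weights) =
  <⇒≢ (2[c+w]<[7+m][8+m] m (s≤s (toℕ≤pred[n] (to fzero))) centre≤) total
  where
  to : Fin (7 + m) → Fin (7 + m)
  to = Bijection.to f
  w : Fin (7 + m) → ℕ
  w = wheelWeight (6 + m) to
  rank : Fin (7 + m) → ℕ
  rank x = toℕ (Bijection.to σ x)
  bottom : ∃ λ x → Bijection.to σ x ≡ fzero
  bottom = Bijection.strictlySurjective σ fzero
  centre≤ : w fzero ≤ 3 * (6 + m) + 2
  centre≤ = centreWeight-bound (5 + m) σ w (w (proj₁ bottom)) e
              (progression-ℕ w rank a e (cong toℕ (proj₂ bottom)) weights)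
              (rimWeight-bounds (s≤s (s≤s z≤n)) to (Bijection.injective f))
  total : 2 * (label to fzero + w fzero) ≡ (7 + m) * (8 + m)
  total = trans (cong (2 *_) (sumFin-permute (suc ∘ toℕ) f)) (sumFin-labels (7 + m))

decideAll : ∀ {n p} {P : Fin n → Set p} (P? : Decidable P) → {True (all? P?)} → ∀ i → P i
decideAll P? {all} = toWitness all

permutation : ∀ {n} (t : Vec (Fin n) n) →
  {True (all? λ i → all? λ j → (lookup t i ≟ lookup t j) →-dec (i ≟ j))} →
  {True (all? λ j → any? λ i → lookup t i ≟ j)} →
  Fin n ⤖ Fin n
permutation t {injective} {surjective} =
  mk⤖ ((λ {i} {j} → toWitness injective i j) , strictlySurjective⇒surjective (toWitness surjective))

-- Each table lists a labeling f (labels minus one, centre first) or the rank map σ.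
wheelAdmitsDAL-3 : WheelAdmitsDAL 3
wheelAdmitsDAL-3 = + 6 , + 1 , +≤+ z≤n , ⤖-id _ , permutation (# 3 ∷ # 2 ∷ # 1 ∷ # 0 ∷ []) ,
  decideAll (λ x → _ ℤ.≟ _)

wheelAdmitsDAL-4 : WheelAdmitsDAL 4
wheelAdmitsDAL-4 = + 10 , + 0 , +≤+ z≤n , permutation (# 4 ∷ # 0 ∷ # 1 ∷ # 3 ∷ # 2 ∷ []) , ⤖-id _ ,
  decideAll (λ x → _ ℤ.≟ _)

wheelAdmitsDAL-5 : WheelAdmitsDAL 5
wheelAdmitsDAL-5 = + 10 , + 1 , +≤+ z≤n , permutation (# 5 ∷ # 0 ∷ # 1 ∷ # 2 ∷ # 3 ∷ # 4 ∷ []) ,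
  permutation (# 5 ∷ # 3 ∷ # 0 ∷ # 2 ∷ # 4 ∷ # 1 ∷ []) , decideAll (λ x → _ ℤ.≟ _)

mainTheorem10 : (n : ℕ) → .{{_ : NonZero n}} → 3 ≤ n →
    WheelAdmitsDAL n ⇔ (3 ≤ n × n ≤ 5)
mainTheorem10 3 3≤n = mk⇔ (λ _ → 3≤n , m≤m+n 3 2) (λ _ → wheelAdmitsDAL-3)
mainTheorem10 4 3≤n = mk⇔ (λ _ → 3≤n , m≤m+n 4 1) (λ _ → wheelAdmitsDAL-4)
mainTheorem10 5 3≤n = mk⇔ (λ _ → 3≤n , ≤-refl) (λ _ → wheelAdmitsDAL-5)
mainTheorem10 (suc (suc (suc (suc (suc (suc m)))))) _ =
  mk⇔ (⊥-elim ∘ ¬wheelAdmitsDAL-6+ m) (λ { (_ , s≤s (s≤s (s≤s (s≤s (s≤s ()))))) })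
mainTheorem10 1 (s≤s ())
mainTheorem10 2 (s≤s (s≤s ()))
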